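{- Let $G$ be a graph, let $m,r,s$ be positive integers, and obtain $G'$ from $G$ by expanding a vertex $v$ into a clique $Q$ (each vertex of $Q$ is adjacent to all other vertices of $Q$ and to exactly the neighbors of $v$ in $G$). If $\lfloor r/m\rfloor$ spies win $\mathrm{RS}(G,m,r,\lfloor r/m\rfloor)$ by a conformal strategy, then $\lfloor r/m\rfloor$ spies also win $\mathrm{RS}(G',m,r,\lfloor r/m\rfloor)$ by a conformal strategy.
   Context: The game $\mathrm{RS}(G,m,r,s)$ is played on a finite graph $G$ by $r$ revolutionaries and $s$ spies. First each revolutionary occupies a vertex, then each spy occupies a vertex (several players may share a vertex). In each subsequent round, each revolutionary may move to an adjacent vertex or stay put, and then each spy may move to an adjacent vertex or stay put; all positions are known to all players. The revolutionaries win if at the end of some round (the initial placement counts as a round) some vertex holds at least $m$ revolutionaries and no spy; the spies win if this never happens. A spy strategy is conformal if at the end of each round, for every vertex $u$, the number of spies at $u$ is at least $\lfloor r(u)/m\rfloor$, where $r(u)$ is the number of revolutionaries at $u$. -}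

module Defs where

open import Data.Nat using (ℕ; zero; suc; _≤_; _/_; NonZero)
open import Data.Fin using (Fin)
open import Data.Fin.Properties using () renaming (_≟_ to _≟ᶠ_)
open import Data.Sum using (_⊎_; inj₁; inj₂)
open import Data.Sum.Properties using (≡-dec)
open import Data.Product using (_×_; _,_; ∃)
open import Data.List using (List; []; _∷_; length; filter)
open import Data.Empty using (⊥)
open import Relation.Nullary using (¬_)
open import Relation.Binary.PropositionalEquality using (_≡_; refl)
import Relation.Binary.PropositionalEquality as Eq
open import Relation.Binary.Definitions using (DecidableEquality)
import Data.List as List
import Data.Fin as Fin

record Graph (V : Set) : Set₁ where
  field
    Adj   : V → V → Set
    adj-sym : ∀ {x y} → Adj x y → Adj y x
    adj-irrefl : ∀ {x} → ¬ Adj x x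

open Graph public

-- Q = {inj₁ v} ∪ {inj₂ j | j : Fin k};
-- the vertex inj₁ v plays the role of one vertex of Q (it keeps exactly
-- the neighbours of v), the inj₂ j are the k further clique vertices.
ExpAdj : ∀ {n} → Graph (Fin n) → Fin n → (k : ℕ) → Fin n ⊎ Fin k → Fin n ⊎ Fin k → Set
ExpAdj G v k (inj₁ a) (inj₁ b) = Adj G a b
ExpAdj G v k (inj₁ a) (inj₂ j) = (a ≡ v) ⊎ Adj G a v
ExpAdj G v k (inj₂ i) (inj₁ b) = (b ≡ v) ⊎ Adj G b v
ExpAdj G v k (inj₂ i) (inj₂ j) = ¬ (i ≡ j)

expand : ∀ {n} → Graph (Fin n) → Fin n → (k : ℕ) → Graph (Fin n ⊎ Fin k)
expand G v k = record { Adj = ExpAdj G v k ; adj-sym = λ {x} {y} → s {x} {y} ; adj-irrefl = λ {x} → ir {x} }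
  where
  s : ∀ {x y} → ExpAdj G v k x y → ExpAdj G v k y x
  s {inj₁ a} {inj₁ b} p = adj-sym G p
  s {inj₁ a} {inj₂ j} p = p
  s {inj₂ i} {inj₁ b} p = p
  s {inj₂ i} {inj₂ j} p = λ e → p (Eq.sym e)
  ir : ∀ {x} → ¬ ExpAdj G v k x x
  ir {inj₁ a} p = adj-irrefl G p
  ir {inj₂ i} p = p refl

Step : ∀ {V} → Graph V → V → V → Set
Step G x y = (x ≡ y) ⊎ Adj G x y

Pos : Set → ℕ → Set
Pos V t = Fin t → V

LegalMove : ∀ {V t} → Graph V → Pos V t → Pos V t → Set
LegalMove G p q = ∀ i → Step G (p i) (q i)

countAt : ∀ {V t} → DecidableEquality V → Pos V t → V → ℕ
countAt {t = t} _≟_ p u = length (filter (λ i → p i ≟ u) (List.allFin t))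

-- A spy strategy (for s spies against r revolutionaries): given the history
-- of completed rounds (most recent first; each entry = revolutionaries'
-- positions and spies' positions at the end of that round) and the
-- revolutionaries' current positions, it yields the spies' new positions.
SpyStrategy : Set → ℕ → ℕ → Set
SpyStrategy V r s = List (Pos V r × Pos V s) → Pos V r → Pos V s

module _ {V : Set} {r s : ℕ} (σ : SpyStrategy V r s) (ρ : ℕ → Pos V r) where
  history : ℕ → List (Pos V r × Pos V s)
  spyPos : ℕ → Pos V s
  history zero = []
  history (suc t) = (ρ t , spyPos t) ∷ history t
  spyPos t = σ (history t) (ρ t)

ConformalAt : ∀ {V r s} → DecidableEquality V → (m : ℕ) → .{{_ : NonZero m}} →
              Pos V r → Pos V s → Set
ConformalAt _≟_ m p q = ∀ u → countAt _≟_ p u / m ≤ countAt _≟_ q u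

-- σ is a conformal strategy for the spies in RS(G, m, r, s): against every
-- play of the revolutionaries, the spies' moves are legal and at the end of
-- every round the position is conformal.  (Conformality implies that no
-- vertex holds ≥ m revolutionaries and no spy, so σ is winning.)
ConformalStrategy : ∀ {V} → DecidableEquality V → Graph V →
                    (m : ℕ) → .{{_ : NonZero m}} → (r s : ℕ) → SpyStrategy V r s → Set
ConformalStrategy _≟_ G m r s σ =
  ∀ (ρ : ℕ → Pos _ r) → (∀ t → LegalMove G (ρ t) (ρ (suc t))) →
    (∀ t → LegalMove G (spyPos σ ρ t) (spyPos σ ρ (suc t)))
    × (∀ t → ConformalAt _≟_ m (ρ t) (spyPos σ ρ t))

SpiesWinConformally : ∀ {V} → DecidableEquality V → Graph V →
                      (m : ℕ) → .{{_ : NonZero m}} → (r s : ℕ) → Set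
SpiesWinConformally _≟_ G m r s = ∃ λ σ → ConformalStrategy _≟_ G m r s σ

_≟ᵉ_ : ∀ {n k} → DecidableEquality (Fin n ⊎ Fin k)
_≟ᵉ_ = ≡-dec _≟ᶠ_ _≟ᶠ_

module Submission where

-- Write G' for G with v expanded into the clique
-- Q = {inj₁ v} ∪ {inj₂ j}, and π : V(G') → V(G) for the map collapsing Q
-- back to v.  Because all vertices of Q are pairwise adjacent and share the
-- neighbourhood of v, a move in G' projects to a move in G and, conversely,
-- every move in G between π x and π y lifts to a move from x to y in G'.
-- The spies on G' therefore simulate the given conformal strategy σ on the
-- projected play π ∘ ρ' of the revolutionaries.  Spies off v stay where σ
-- puts them; the spies σ puts on v are spread over Q so that every x ∈ Q
-- gets ⌊r(x)/m⌋ of them.  There are enough of them, since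
--   Σ_{x ∈ Q} ⌊r(x)/m⌋ ≤ ⌊Σ_{x ∈ Q} r(x) / m⌋ = ⌊r_π(v)/m⌋ ≤ #spies at v,
-- the last step being conformality of σ at v.

open import Defs
open import Data.Nat using (ℕ; _<_; _/_; NonZero)
open import Data.Fin using (Fin)
open import Data.Fin.Properties using (_≟_)

open import Data.Bool using (if_then_else_)
open import Data.Fin using (zero; suc)
open import Data.List using (List; []; _∷_; _++_; length; replicate; filter; tabulate)
open import Data.List.Properties using (length-++; length-replicate; filter-≐)
open import Data.List.Relation.Unary.All using (All; []; _∷_)
open import Data.List.Relation.Unary.All.Properties using (++⁺; replicate⁺)
open import Data.Nat using (zero; suc; _+_; _*_; _≤_; z≤n; s≤s; s≤s⁻¹)
open import Data.Nat.DivMod using (m*n/n≡m; m/n*n≤m; /-monoˡ-≤)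
open import Data.Nat.Properties
  using (≤-refl; ≤-trans; +-mono-≤; +-monoʳ-≤; m≤n+m; +-identityʳ; *-distribʳ-+;
         +-0-commutativeMonoid; module ≤-Reasoning)
open import Data.Product using (_×_; _,_; proj₁; proj₂)
open import Data.Sum using (_⊎_; inj₁; inj₂)
open import Function using (_∘_)
open import Relation.Binary.Definitions using (DecidableEquality)
open import Relation.Binary.PropositionalEquality
  using (_≡_; refl; sym; trans; cong; cong₂; subst; subst₂; module ≡-Reasoning)
open import Relation.Nullary using (¬_; Dec; yes; no; does; contradiction)

open import Algebra.Properties.CommutativeMonoid.Sum +-0-commutativeMonoid
  using (sum-syntax; ∑-comm; sum-cong-≗; sum-replicate-zero)

𝟙 : ∀ {P : Set} → Dec P → ℕ
𝟙 d = if does d then 1 else 0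

𝟙-holds : ∀ {P : Set} (d : Dec P) → P → 𝟙 d ≡ 1
𝟙-holds (yes _) _ = refl
𝟙-holds (no ¬p) p = contradiction p ¬p

length-filter-tabulate : ∀ {A : Set} {P : A → Set} (P? : ∀ a → Dec (P a)) {t} (f : Fin t → A) →
  length (filter P? (tabulate f)) ≡ ∑[ i < t ] 𝟙 (P? (f i))
length-filter-tabulate P? {zero} f = refl
length-filter-tabulate P? {suc t} f with P? (f zero)
... | yes _ = cong suc (length-filter-tabulate P? (f ∘ suc))
... | no _ = length-filter-tabulate P? (f ∘ suc)

countAt-sum : ∀ {V : Set} (_≟ⱽ_ : DecidableEquality V) {t} (p : Pos V t) u →
  countAt _≟ⱽ_ p u ≡ ∑[ i < t ] 𝟙 (p i ≟ⱽ u)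
countAt-sum _≟ⱽ_ p u = length-filter-tabulate (λ i → p i ≟ⱽ u) (λ i → i)

countAt-fibre : ∀ {A B : Set} (_≟ᴬ_ : DecidableEquality A) (_≟ᴮ_ : DecidableEquality B)
  (f : A → B) {a : A} → (∀ x → f x ≡ f a → x ≡ a) →
  ∀ {t} {p : Pos A t} {q : Pos B t} → (∀ i → f (p i) ≡ q i) →
  countAt _≟ᴬ_ p a ≡ countAt _≟ᴮ_ q (f a)
countAt-fibre _≟ᴬ_ _≟ᴮ_ f {a} alone {p = p} {q = q} fp≡q =
  cong length (filter-≐ (λ i → p i ≟ᴬ a) (λ i → q i ≟ᴮ f a)
    ((λ {i} pi≡a → trans (sym (fp≡q i)) (cong f pi≡a)) ,
     (λ {i} qi≡fa → alone (p i) (trans (fp≡q i) qi≡fa)))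
    (tabulate (λ i → i)))

∑-delta : ∀ {k} (i : Fin k) → ∑[ j < k ] 𝟙 (i ≟ j) ≡ 1
∑-delta {suc k} zero = cong suc (sum-replicate-zero k)
∑-delta (suc i) = ∑-delta i

/-superadditive : ∀ a b m .{{_ : NonZero m}} → a / m + b / m ≤ (a + b) / m
/-superadditive a b m = begin
  a / m + b / m           ≡⟨ sym (m*n/n≡m (a / m + b / m) m) ⟩
  (a / m + b / m) * m / m ≤⟨ /-monoˡ-≤ m multiple≤ ⟩
  (a + b) / m             ∎
  where
  open ≤-Reasoning
  multiple≤ : (a / m + b / m) * m ≤ a + b
  multiple≤ = subst (_≤ a + b) (sym (*-distribʳ-+ m (a / m) (b / m)))
                (+-mono-≤ (m/n*n≤m a m) (m/n*n≤m b m))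

∑-/ : ∀ {K} (a : Fin K → ℕ) m .{{_ : NonZero m}} → ∑[ j < K ] (a j / m) ≤ (∑[ j < K ] a j) / m
∑-/ {zero} a m = z≤n
∑-/ {suc K} a m =
  ≤-trans (+-monoʳ-≤ (a zero / m) (∑-/ (a ∘ suc) m)) (/-superadditive (a zero) _ m)

module _ {A : Set} (_≟ᴬ_ : DecidableEquality A) where

  multiplicity : A → List A → ℕ
  multiplicity x [] = 0
  multiplicity x (y ∷ ys) = 𝟙 (y ≟ᴬ x) + multiplicity x ys

  multiplicity-++ʳ : ∀ x xs ys → multiplicity x ys ≤ multiplicity x (xs ++ ys)
  multiplicity-++ʳ x [] ys = ≤-refl
  multiplicity-++ʳ x (y ∷ xs) ys = ≤-trans (multiplicity-++ʳ x xs ys) (m≤n+m _ _)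

  multiplicity-replicate-++ : ∀ x c ys → c ≤ multiplicity x (replicate c x ++ ys)
  multiplicity-replicate-++ x zero ys = z≤n
  multiplicity-replicate-++ x (suc c) ys rewrite 𝟙-holds (x ≟ᴬ x) refl =
    s≤s (multiplicity-replicate-++ x c ys)

demands : ∀ {A : Set} {K} → (Fin K → A) → (Fin K → ℕ) → List A
demands {K = zero} e d = []
demands {K = suc K} e d = replicate (d zero) (e zero) ++ demands (e ∘ suc) (d ∘ suc)

length-demands : ∀ {A : Set} {K} (e : Fin K → A) d → length (demands e d) ≡ ∑[ j < K ] d j
length-demands {K = zero} e d = refl
length-demands {K = suc K} e d = begin
  length (replicate (d zero) (e zero) ++ demands (e ∘ suc) (d ∘ suc))
    ≡⟨ length-++ (replicate (d zero) (e zero)) ⟩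
  length (replicate (d zero) (e zero)) + length (demands (e ∘ suc) (d ∘ suc))
    ≡⟨ cong₂ _+_ (length-replicate (d zero)) (length-demands (e ∘ suc) (d ∘ suc)) ⟩
  d zero + ∑[ j < K ] d (suc j) ∎
  where open ≡-Reasoning

demands-multiplicity : ∀ {A : Set} (_≟ᴬ_ : DecidableEquality A) {K} (e : Fin K → A) d j →
  d j ≤ multiplicity _≟ᴬ_ (e j) (demands e d)
demands-multiplicity _≟ᴬ_ e d zero = multiplicity-replicate-++ _≟ᴬ_ (e zero) (d zero) _
demands-multiplicity _≟ᴬ_ e d (suc j) =
  ≤-trans (demands-multiplicity _≟ᴬ_ (e ∘ suc) (d ∘ suc) j)
          (multiplicity-++ʳ _≟ᴬ_ (e (suc j)) (replicate (d zero) (e zero)) _)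

All-demands : ∀ {A : Set} {P : A → Set} {K} (e : Fin K → A) d → (∀ j → P (e j)) → All P (demands e d)
All-demands {K = zero} e d Pe = []
All-demands {K = suc K} e d Pe = ++⁺ (replicate⁺ (d zero) (Pe zero)) (All-demands (e ∘ suc) (d ∘ suc) (Pe ∘ suc))

module Expansion {n : ℕ} (G : Graph (Fin n)) (v : Fin n) (k : ℕ) where

  V' : Set
  V' = Fin n ⊎ Fin k

  G' : Graph V'
  G' = expand G v k

  π : V' → Fin n
  π (inj₁ a) = a
  π (inj₂ _) = v

  clique : Fin (suc k) → V'
  clique zero = inj₁ v
  clique (suc j) = inj₂ j

  InClique : V' → Set
  InClique x = π x ≡ v

  clique-in : ∀ j → InClique (clique j)
  clique-in zero = refl
  clique-in (suc j) = refl

  step-project : ∀ {x y} → Step G' x y → Step G (π x) (π y)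
  step-project (inj₁ refl) = inj₁ refl
  step-project {inj₁ a} {inj₁ b} (inj₂ a~b) = inj₂ a~b
  step-project {inj₁ a} {inj₂ j} (inj₂ a≡v⊎a~v) = a≡v⊎a~v
  step-project {inj₂ i} {inj₁ b} (inj₂ (inj₁ b≡v)) = inj₁ (sym b≡v)
  step-project {inj₂ i} {inj₁ b} (inj₂ (inj₂ b~v)) = inj₂ (adj-sym G b~v)
  step-project {inj₂ i} {inj₂ j} (inj₂ _) = inj₁ refl

  step-lift : ∀ x y → Step G (π x) (π y) → Step G' x y
  step-lift (inj₁ a) (inj₁ b) (inj₁ refl) = inj₁ refl
  step-lift (inj₁ a) (inj₁ b) (inj₂ a~b) = inj₂ a~b
  step-lift (inj₁ a) (inj₂ j) a≡v⊎a~v = inj₂ a≡v⊎a~v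
  step-lift (inj₂ i) (inj₁ b) (inj₁ v≡b) = inj₂ (inj₁ (sym v≡b))
  step-lift (inj₂ i) (inj₁ b) (inj₂ v~b) = inj₂ (inj₂ (adj-sym G v~b))
  step-lift (inj₂ i) (inj₂ j) _ with i ≟ j
  ... | yes refl = inj₁ refl
  ... | no i≢j = inj₂ i≢j

  clique-indicator : ∀ a → ∑[ j < suc k ] 𝟙 (a ≟ᵉ clique j) ≡ 𝟙 (π a ≟ v)
  clique-indicator (inj₁ b) = trans (cong (𝟙 (b ≟ v) +_) (sum-replicate-zero k)) (+-identityʳ _)
  clique-indicator (inj₂ i) = trans (∑-delta i) (sym (𝟙-holds (v ≟ v) refl))

  countAt-clique : ∀ {t} (c : Pos V' t) → ∑[ j < suc k ] countAt _≟ᵉ_ c (clique j) ≡ countAt _≟_ (π ∘ c) v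
  countAt-clique {t} c = begin
    ∑[ j < suc k ] countAt _≟ᵉ_ c (clique j)        ≡⟨ sum-cong-≗ (λ j → countAt-sum _≟ᵉ_ c (clique j)) ⟩
    ∑[ j < suc k ] ∑[ i < t ] 𝟙 (c i ≟ᵉ clique j)   ≡⟨ ∑-comm (λ j i → 𝟙 (c i ≟ᵉ clique j)) ⟩
    ∑[ i < t ] ∑[ j < suc k ] 𝟙 (c i ≟ᵉ clique j)   ≡⟨ sum-cong-≗ (λ i → clique-indicator (c i)) ⟩
    ∑[ i < t ] 𝟙 (π (c i) ≟ v)                       ≡⟨ sym (countAt-sum _≟_ (π ∘ c) v) ⟩
    countAt _≟_ (π ∘ c) v                            ∎
    where open ≡-Reasoning

  countAt-outside : ∀ {u} → ¬ u ≡ v → ∀ {t} {p : Pos V' t} {q : Pos (Fin n) t} →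
    (∀ i → π (p i) ≡ q i) → countAt _≟ᵉ_ p (inj₁ u) ≡ countAt _≟_ q u
  countAt-outside {u} u≢v = countAt-fibre _≟ᵉ_ _≟_ π alone
    where
    alone : ∀ x → π x ≡ u → x ≡ inj₁ u
    alone (inj₁ a) a≡u = cong inj₁ a≡u
    alone (inj₂ j) v≡u = contradiction (sym v≡u) u≢v

  -- Lifting spy positions along a list T of targets in Q: a spy at v takes
  -- the next unused target (or inj₁ v once T is used up), any other spy
  -- stays at its vertex.  `place` gives the head spy's vertex and the
  -- targets left for the others.
  place : ∀ {a} → Dec (a ≡ v) → List V' → V' × List V'
  place {a} (no _) T = inj₁ a , T
  place (yes _) [] = inj₁ v , []
  place (yes _) (x ∷ T) = x , T

  liftSpies : List V' → ∀ {s} → Pos (Fin n) s → Pos V' s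
  liftSpies T {suc s} q zero = proj₁ (place (q zero ≟ v) T)
  liftSpies T {suc s} q (suc i) = liftSpies (proj₂ (place (q zero ≟ v) T)) (q ∘ suc) i

  lift-projects : ∀ T {s} (q : Pos (Fin n) s) → All InClique T → ∀ i → π (liftSpies T q i) ≡ q i
  lift-projects T {suc s} q T⊆Q zero with q zero ≟ v | T | T⊆Q
  ... | no _    | _     | _       = refl
  ... | yes q≡v | []    | _       = sym q≡v
  ... | yes q≡v | _ ∷ _ | x∈Q ∷ _ = trans x∈Q (sym q≡v)
  lift-projects T {suc s} q T⊆Q (suc i) with q zero ≟ v | T | T⊆Q
  ... | no _ | T′     | T′⊆Q     = lift-projects T′ (q ∘ suc) T′⊆Q i
  ... | yes _ | []     | _        = lift-projects [] (q ∘ suc) [] i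
  ... | yes _ | _ ∷ T′ | _ ∷ T′⊆Q = lift-projects T′ (q ∘ suc) T′⊆Q i

  lift-covers : ∀ T {s} (q : Pos (Fin n) s) x → length T ≤ countAt _≟_ q v →
    multiplicity _≟ᵉ_ x T ≤ countAt _≟ᵉ_ (liftSpies T q) x
  lift-covers T q x fits =
    subst (multiplicity _≟ᵉ_ x T ≤_) (sym (countAt-sum _≟ᵉ_ (liftSpies T q) x))
      (covers T q (subst (length T ≤_) (countAt-sum _≟_ q v) fits))
    where
    covers : ∀ T {s} (q : Pos (Fin n) s) → length T ≤ ∑[ i < s ] 𝟙 (q i ≟ v) →
      multiplicity _≟ᵉ_ x T ≤ ∑[ i < s ] 𝟙 (liftSpies T q i ≟ᵉ x)
    covers [] q _ = z≤n
    covers (t ∷ T) {suc s} q fits with q zero ≟ v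
    ... | yes _ = +-monoʳ-≤ (𝟙 (t ≟ᵉ x)) (covers T (q ∘ suc) (s≤s⁻¹ fits))
    ... | no _ = ≤-trans (covers (t ∷ T) (q ∘ suc) fits) (m≤n+m _ _)

  module Spies (m : ℕ) .{{_ : NonZero m}} (r s : ℕ) where

    demand : Pos V' r → V' → ℕ
    demand c x = countAt _≟ᵉ_ c x / m

    targets : Pos V' r → List V'
    targets c = demands clique (demand c ∘ clique)

    clique-targets : ∀ {c} → All InClique (targets c)
    clique-targets {c} = All-demands clique (demand c ∘ clique) clique-in

    targets-fit : (c : Pos V' r) (q : Pos (Fin n) s) → ConformalAt _≟_ m (π ∘ c) q →
      length (targets c) ≤ countAt _≟_ q v
    targets-fit c q conformal = begin
      length (targets c)                                 ≡⟨ length-demands clique (demand c ∘ clique) ⟩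
      ∑[ j < suc k ] demand c (clique j)                 ≤⟨ ∑-/ (λ j → countAt _≟ᵉ_ c (clique j)) m ⟩
      (∑[ j < suc k ] countAt _≟ᵉ_ c (clique j)) / m     ≡⟨ cong (_/ m) (countAt-clique c) ⟩
      countAt _≟_ (π ∘ c) v / m                          ≤⟨ conformal v ⟩
      countAt _≟_ q v                                    ∎
      where open ≤-Reasoning

    lift-conformal : (c : Pos V' r) (q : Pos (Fin n) s) → ConformalAt _≟_ m (π ∘ c) q →
      ConformalAt _≟ᵉ_ m c (liftSpies (targets c) q)
    lift-conformal c q conformal = conformal′
      where
      q′ : Pos V' s
      q′ = liftSpies (targets c) q

      q′-projects : ∀ i → π (q′ i) ≡ q i
      q′-projects = lift-projects (targets c) q clique-targets

      on-clique : ∀ j → demand c (clique j) ≤ countAt _≟ᵉ_ q′ (clique j)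
      on-clique j = ≤-trans (demands-multiplicity _≟ᵉ_ clique (demand c ∘ clique) j)
                            (lift-covers (targets c) q (clique j) (targets-fit c q conformal))

      conformal′ : ConformalAt _≟ᵉ_ m c q′
      conformal′ (inj₂ j) = on-clique (suc j)
      conformal′ (inj₁ u) with u ≟ v
      ... | yes refl = on-clique zero
      ... | no u≢v = subst₂ (λ a b → a / m ≤ b)
                       (sym (countAt-outside u≢v {p = c} (λ _ → refl)))
                       (sym (countAt-outside u≢v q′-projects))
                       (conformal u)

    module _ (σ : SpyStrategy (Fin n) r s) where

      projectHistory : List (Pos V' r × Pos V' s) → List (Pos (Fin n) r × Pos (Fin n) s)
      projectHistory [] = []
      projectHistory ((c , _) ∷ h) = (π ∘ c , σ (projectHistory h) (π ∘ c)) ∷ projectHistory h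

      liftStrategy : SpyStrategy V' r s
      liftStrategy h c = liftSpies (targets c) (σ (projectHistory h) (π ∘ c))

      module _ (ρ′ : ℕ → Pos V' r) where

        projectedPlay : ℕ → Pos (Fin n) r
        projectedPlay t = π ∘ ρ′ t

        projectHistory-history : ∀ t → projectHistory (history liftStrategy ρ′ t) ≡ history σ projectedPlay t
        projectHistory-history zero = refl
        projectHistory-history (suc t) =
          cong (λ h → (projectedPlay t , σ h (projectedPlay t)) ∷ h) (projectHistory-history t)

        liftStrategy-spyPos : ∀ t → spyPos liftStrategy ρ′ t ≡ liftSpies (targets (ρ′ t)) (spyPos σ projectedPlay t)
        liftStrategy-spyPos t =
          cong (λ h → liftSpies (targets (ρ′ t)) (σ h (projectedPlay t))) (projectHistory-history t)

      liftStrategy-conformal : ConformalStrategy _≟_ G m r s σ → ConformalStrategy _≟ᵉ_ G' m r s liftStrategy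
      liftStrategy-conformal σ-conformal ρ′ ρ′-legal = legal , conformal
        where
        projected-legal : ∀ t → LegalMove G (projectedPlay ρ′ t) (projectedPlay ρ′ (suc t))
        projected-legal t i = step-project (ρ′-legal t i)

        q : ℕ → Pos (Fin n) s
        q = spyPos σ (projectedPlay ρ′)

        σ-legal : ∀ t → LegalMove G (q t) (q (suc t))
        σ-legal = proj₁ (σ-conformal (projectedPlay ρ′) projected-legal)

        σ-conf : ∀ t → ConformalAt _≟_ m (projectedPlay ρ′ t) (q t)
        σ-conf = proj₂ (σ-conformal (projectedPlay ρ′) projected-legal)

        legal : ∀ t → LegalMove G' (spyPos liftStrategy ρ′ t) (spyPos liftStrategy ρ′ (suc t))
        legal t i rewrite liftStrategy-spyPos ρ′ t | liftStrategy-spyPos ρ′ (suc t) =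
          step-lift _ _ (subst₂ (Step G) (sym (projects t)) (sym (projects (suc t))) (σ-legal t i))
          where
          projects : ∀ τ → π (liftSpies (targets (ρ′ τ)) (q τ) i) ≡ q τ i
          projects τ = lift-projects (targets (ρ′ τ)) (q τ) clique-targets i

        conformal : ∀ t → ConformalAt _≟ᵉ_ m (ρ′ t) (spyPos liftStrategy ρ′ t)
        conformal t rewrite liftStrategy-spyPos ρ′ t = lift-conformal (ρ′ t) (q t) (σ-conf t)

-- Proposition 3.1.
proposition3p1 : ∀ {n : ℕ} (G : Graph (Fin n)) (v : Fin n) (k : ℕ)
    (m r : ℕ) .{{_ : NonZero m}} → 0 < r → 0 < r / m →
    SpiesWinConformally _≟_ G m r (r / m) →
    SpiesWinConformally _≟ᵉ_ (expand G v k) m r (r / m)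
proposition3p1 G v k m r _ _ (σ , σ-conformal) =
  liftStrategy σ , liftStrategy-conformal σ σ-conformal
  where open Expansion.Spies G v k m r (r / m)
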